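{- Let $G$ be a (finite, simple, connected) graph of order $n\ge 9$ with $\tau(G)\le n/2$. Then $\beta_p(G)\le n-3$.
   Context: Two vertices $u,v$ are twins if $N(u)\setminus\{v\}=N(v)\setminus\{u\}$; twin classes are the equivalence classes of this relation and $\tau(G)$ is the maximum cardinality of a twin class. For $u$ a vertex and $S$ a vertex set, $d(u,S)=\min_{w\in S}d(u,w)$. A partition $\Pi=\{S_1,\dots,S_k\}$ of $V(G)$ is locating if the vectors $r(u|\Pi)=(d(u,S_1),\dots,d(u,S_k))$ are pairwise distinct over $u\in V(G)$; $\beta_p(G)$ is the minimum size of a locating partition. -}

module Defs where

open import Data.Nat using (ℕ; zero; suc; _<_)
open import Data.Fin using (Fin)
open import Data.Bool using (Bool; true; false)
open import Data.Product using (Σ; ∃; ∃-syntax; _×_; _,_)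
open import Relation.Binary.PropositionalEquality using (_≡_; _≢_)
open import Relation.Nullary using (¬_)
open import Function.Definitions using (Injective; Surjective)

record Graph (n : ℕ) : Set where
  field
    adj   : Fin n → Fin n → Bool
    sym   : ∀ u v → adj u v ≡ adj v u
    irrefl : ∀ u → adj u u ≡ false

open Graph public

Adj : ∀ {n} → Graph n → Fin n → Fin n → Set
Adj G u v = adj G u v ≡ true

data Walk {n : ℕ} (G : Graph n) : Fin n → Fin n → ℕ → Set where
  here : ∀ u → Walk G u u zero
  step : ∀ {u v w k} → Adj G u v → Walk G v w k → Walk G u w (suc k)

Connected : ∀ {n} → Graph n → Set
Connected G = ∀ u v → ∃[ k ] Walk G u v k

Twins : ∀ {n} → Graph n → Fin n → Fin n → Set
Twins G u v = ∀ w → w ≢ u → w ≢ v → adj G u w ≡ adj G v w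

-- τ(G) ≤ n/2: any m pairwise distinct vertices of the twin class of u
-- (all twin to u) satisfy m ≤ n/2, i.e. 2·m ≤ n.
open import Data.Nat using (_*_; _≤_)
TwinBoundHalf : ∀ {n} → Graph n → Set
TwinBoundHalf {n} G =
  ∀ u (m : ℕ) (f : Fin m → Fin n) → Injective _≡_ _≡_ f →
    (∀ j → Twins G u (f j)) → 2 * m ≤ n

-- A partition of V(G) into k (nonempty) classes S_0,…,S_{k-1}, encoded by
-- a surjective class map c : Fin n → Fin k  (S_i = c⁻¹(i)).
-- d(u, S_i) = d : some vertex of S_i is at distance d from u and no vertex
-- of S_i is reachable by a walk of length < d.
SetDist : ∀ {n k} → Graph n → (Fin n → Fin k) → Fin n → Fin k → ℕ → Set
SetDist G c u i d =
  (∃[ w ] (c w ≡ i × Walk G u w d)) ×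
  (∀ w e → c w ≡ i → e < d → ¬ Walk G u w e)

-- Locating: distinct vertices have distinct distance vectors r(u|Π).
Locating : ∀ {n k} → Graph n → (Fin n → Fin k) → Set
Locating G c =
  ∀ u v → u ≢ v → ∃[ i ] ∃[ d ] (SetDist G c u i d × ¬ SetDist G c v i d)

PartitionDimAtMost : ∀ {n} → Graph n → ℕ → Set
PartitionDimAtMost {n} G b =
  ∃[ k ] (k ≤ b × Σ (Fin n → Fin k) λ c → Surjective _≡_ _≡_ c × Locating G c)

-- If three disjoint pairs {aᵢ, bᵢ} have separators wᵢ, lying outside all six vertices and
-- adjacent to exactly one of aᵢ, bᵢ, then merging each pair and keeping all other vertices
-- as singletons is a locating partition into n − 3 classes: merged vertices are told apart
-- by their distance to the singleton {wᵢ}. A vertex with three neighbours and three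
-- non-neighbours yields such pairs directly. Otherwise each vertex w has at most two
-- atypical vertices, those whose adjacency to w differs from w's majority adjacency.
-- Vertices atypical for nobody are pairwise twins, so τ(G) ≤ n/2 gives five vertices that
-- are atypical for someone. The pattern of their witnesses is a self-map of a five-element
-- set, which has an independent triple or an odd cycle; along an odd cycle majorities cannot
-- alternate, so some arrow is two-way. Either way three of the five get witnesses outside
-- them, and three further vertices (n ≥ 9) complete the pairs by a 3×3 case analysis.

module Submission where

open import Defs hiding (sym)
open import Data.Bool using (Bool; true; false)
import Data.Bool.Properties as Bool
open import Data.Empty using (⊥; ⊥-elim)
open import Data.Fin using (Fin; zero; suc; punchOut; punchIn; inject≤; _↑ˡ_; _↑ʳ_)
open import Data.Fin.Patterns using (0F; 1F; 2F; 3F; 4F)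
open import Data.Fin.Properties
  using (_≟_; all?; any?; punchOut-injective; punchOut-cong; punchOut-punchIn; punchInᵢ≢i;
         inject≤-injective; injective⇒≤)
open import Data.List using (List; []; _∷_; length; filter; allFin)
open import Data.List.Properties using (length-tabulate)
import Data.List as List
open import Data.List.Membership.Propositional.Properties using (∈-filter⁺; ∈-allFin; ∈-lookup)
open import Data.List.Relation.Unary.All as ListAll using ([]; _∷_)
open import Data.List.Relation.Unary.All.Properties using (all-filter)
open import Data.List.Relation.Unary.Any as Any using (Any)
open import Data.List.Relation.Unary.Any.Properties using (lookup-index)
open import Data.List.Relation.Unary.AllPairs as ListAllPairs using ([]; _∷_)
import Data.List.Relation.Unary.Unique.Propositional as ListUnique
open import Data.List.Relation.Unary.Unique.Propositional.Properties using (allFin⁺; filter⁺)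
open import Data.Nat using (ℕ; zero; suc; _+_; _*_; _∸_; _≤_; _<_; _≤?_; z≤n; s≤s)
open import Data.Nat.Properties
  using (≤-refl; ≤-trans; +-suc; +-identityʳ; +-cancelˡ-≤; +-monoˡ-≤; +-mono-≤; ≰⇒>; <-cmp; <-irrefl; m≤m+n)
open import Data.Product using (Σ; ∃; ∃-syntax; _×_; _,_; proj₁; proj₂)
open import Data.Sum using (_⊎_; inj₁; inj₂; [_,_]; swap)
import Data.Sum as Sum
open import Data.Sum.Properties using () renaming (≡-dec to ⊎-≡-dec)
open import Data.Vec using (Vec; []; _∷_; lookup; tabulate; _++_)
import Data.Vec as Vec
open import Data.Vec.Properties using (lookup∘tabulate; lookup-++ˡ; lookup-++ʳ)
open import Data.Vec.Relation.Unary.All as All using (All; []; _∷_)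
import Data.Vec.Relation.Unary.All.Properties as All
open import Data.Vec.Relation.Unary.AllPairs using (allPairs?; []; _∷_)
open import Data.Vec.Relation.Unary.Unique.Propositional using (Unique)
import Data.Vec.Relation.Unary.Unique.Propositional.Properties as Unique
open import Data.Vec.Relation.Binary.Pointwise.Inductive as Pointwise using (Pointwise; []; _∷_)
open import Function using (_∘_; id)
import Function.Construct.Composition as Compose
open import Function.Definitions using (Injective; Surjective)
open import Relation.Binary.Definitions using (DecidableEquality; tri<; tri≈; tri>)
open import Relation.Binary.PropositionalEquality
  using (_≡_; _≢_; refl; sym; trans; cong; subst; _≗_)
open import Relation.Nullary using (Dec; yes; no; ¬_; ¬?; does; contradiction)
open import Relation.Nullary.Decidable
  using (True; toWitness; from-yes; map′; _×-dec_; _⊎-dec_; _→-dec_; decidable-stable)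
open import Relation.Unary using (Decidable; ∁)
open import Relation.Unary.Properties using (∁?)

-- Exhaustive checks on small finite sets

Searchable : Set → Set₁
Searchable A = ∀ {P : A → Set} → Decidable P → Dec (∀ a → P a)

searchable-Bool : Searchable Bool
searchable-Bool P? =
  map′ (λ { (p , q) true → p ; (p , q) false → q }) (λ h → h true , h false) (P? true ×-dec P? false)

searchable-⊎ : ∀ {A B} → Searchable A → Searchable B → Searchable (A ⊎ B)
searchable-⊎ S T P? =
  map′ (λ { (p , q) (inj₁ a) → p a ; (p , q) (inj₂ b) → q b }) (λ h → h ∘ inj₁ , h ∘ inj₂)
    (S (P? ∘ inj₁) ×-dec T (P? ∘ inj₂))

searchable-Vec : ∀ {A} → Searchable A → ∀ k → Searchable (Vec A k)
searchable-Vec S zero P? = map′ (λ { p [] → p }) (λ h → h []) (P? [])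
searchable-Vec S (suc k) P? =
  map′ (λ { h (a ∷ v) → h a v }) (λ h a v → h (a ∷ v)) (S λ a → searchable-Vec S k λ v → P? (a ∷ v))

injective? : ∀ {A B : Set} → Searchable A → DecidableEquality A → DecidableEquality B →
  (f : A → B) → Dec (Injective _≡_ _≡_ f)
injective? S _≟A_ _≟B_ f =
  map′ (λ h {x} {y} → h x y) (λ h x y → h) (S λ x → S λ y → (f x ≟B f y) →-dec (x ≟A y))

unique? : ∀ {A : Set} {k} → DecidableEquality A → (xs : Vec A k) → Dec (Unique xs)
unique? _≟A_ = allPairs? λ x y → ¬? (x ≟A y)

Embedding : ℕ → ℕ → Set
Embedding m n = Σ (Fin m → Fin n) (Injective _≡_ _≡_)

embedding : ∀ {m n} (f : Fin m → Fin n) → {True (injective? all? _≟_ _≟_ f)} → Embedding m n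
embedding f {p} = f , toWitness p

tab3 : ∀ {A : Set} → A → A → A → Fin 3 → A
tab3 x y z 0F = x
tab3 x y z 1F = y
tab3 x y z 2F = z

tab5 : ∀ {A : Set} → A → A → A → A → A → Fin 5 → A
tab5 x y z t u 0F = x
tab5 x y z t u 1F = y
tab5 x y z t u 2F = z
tab5 x y z t u 3F = t
tab5 x y z t u 4F = u

next₅ : Fin 5 → Fin 5
next₅ = tab5 1F 2F 3F 4F 0F

-- q j ≡ k with k ≢ j is read as an arrow from k to j; fixed points carry no arrow.
data IndependentTripleOrOddCycle (q : Fin 5 → Fin 5) : Set where
  independent : (ι : Embedding 3 5) → (∀ a b → a ≢ b → q (proj₁ ι a) ≢ proj₁ ι b) →
    IndependentTripleOrOddCycle q
  triangle : (ρ : Embedding 5 5) → let r = proj₁ ρ in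
    q (r 1F) ≡ r 0F → q (r 2F) ≡ r 1F → q (r 0F) ≡ r 2F → IndependentTripleOrOddCycle q
  pentagon : (ρ : Embedding 5 5) → let r = proj₁ ρ in
    (∀ i → q (r (next₅ i)) ≡ r i) → IndependentTripleOrOddCycle q

independentTripleOrOddCycle-resp : ∀ {q q′} → q ≗ q′ →
  IndependentTripleOrOddCycle q → IndependentTripleOrOddCycle q′
independentTripleOrOddCycle-resp q≗q′ (independent ι h) =
  independent ι λ a b a≢b e → h a b a≢b (trans (q≗q′ _) e)
independentTripleOrOddCycle-resp q≗q′ (triangle ρ e₁ e₂ e₃) =
  triangle ρ (trans (sym (q≗q′ _)) e₁) (trans (sym (q≗q′ _)) e₂) (trans (sym (q≗q′ _)) e₃)
independentTripleOrOddCycle-resp q≗q′ (pentagon ρ e) = pentagon ρ λ i → trans (sym (q≗q′ _)) (e i)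

module SelfMapSearch (q : Fin 5 → Fin 5) where

  triples : List (Embedding 3 5)
  triples = embedding (tab3 0F 1F 2F) ∷ embedding (tab3 0F 1F 3F) ∷ embedding (tab3 0F 1F 4F) ∷
            embedding (tab3 0F 2F 3F) ∷ embedding (tab3 0F 2F 4F) ∷ embedding (tab3 0F 3F 4F) ∷
            embedding (tab3 1F 2F 3F) ∷ embedding (tab3 1F 2F 4F) ∷ embedding (tab3 1F 3F 4F) ∷
            embedding (tab3 2F 3F 4F) ∷ []

  -- A cycle is determined by any of its points, read off backwards along q.
  orbit₃ : Fin 5 → Fin 5 → Fin 5 → Fin 5 → Fin 5
  orbit₃ x = tab5 x (q (q x)) (q x)

  orbit₅ : Fin 5 → Fin 5 → Fin 5
  orbit₅ x = tab5 x (q (q (q (q x)))) (q (q (q x))) (q (q x)) (q x)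

  Found : Set
  Found = Any (λ ι → ∀ a b → a ≢ b → q (proj₁ ι a) ≢ proj₁ ι b) triples
        ⊎ (∃[ x ] ∃[ t ] ∃[ u ] let r = orbit₃ x t u in
             Injective _≡_ _≡_ r × q (r 1F) ≡ r 0F × q (r 2F) ≡ r 1F × q (r 0F) ≡ r 2F)
        ⊎ (∃[ x ] Injective _≡_ _≡_ (orbit₅ x) × (∀ i → q (orbit₅ x (next₅ i)) ≡ orbit₅ x i))

  found? : Dec Found
  found? = Any.any? (λ ι → all? λ a → all? λ b → ¬? (a ≟ b) →-dec ¬? (q (proj₁ ι a) ≟ proj₁ ι b))
             triples
    ⊎-dec (any? λ x → any? λ t → any? λ u → let r = orbit₃ x t u in
             injective? all? _≟_ _≟_ r ×-dec (q (r 1F) ≟ r 0F) ×-dec (q (r 2F) ≟ r 1F) ×-dec (q (r 0F) ≟ r 2F))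
    ⊎-dec (any? λ x → injective? all? _≟_ _≟_ (orbit₅ x) ×-dec
             all? λ i → q (orbit₅ x (next₅ i)) ≟ orbit₅ x i)

  found⇒certificate : Found → IndependentTripleOrOddCycle q
  found⇒certificate (inj₁ p) = let (ι , h) = Any.satisfied p in independent ι h
  found⇒certificate (inj₂ (inj₁ (x , t , u , r-inj , e₁ , e₂ , e₃))) =
    triangle (orbit₃ x t u , r-inj) e₁ e₂ e₃
  found⇒certificate (inj₂ (inj₂ (x , r-inj , e))) = pentagon (orbit₅ x , r-inj) e

-- Decided by checking all 5⁵ self-maps.
independentTripleOrOddCycle : ∀ q → IndependentTripleOrOddCycle q
independentTripleOrOddCycle q =
  independentTripleOrOddCycle-resp (lookup∘tabulate q) (found⇒certificate _ (found (tabulate q)))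
  where
  open SelfMapSearch
  found : ∀ v → Found (lookup v)
  found = from-yes (searchable-Vec all? 5 λ v → found? (lookup v))

data TransversalOrObstruction (M : Fin 3 → Fin 3 → Bool) : Set where
  heavyRow : ∀ i j k → j ≢ k → M i j ≡ true → M i k ≡ true → TransversalOrObstruction M
  transversal : (π : Embedding 3 3) → (∀ i → M i (proj₁ π i) ≡ false) → TransversalOrObstruction M
  fullColumn : (π : Embedding 3 3) → (∀ i → M i (proj₁ π 0F) ≡ true) → TransversalOrObstruction M

transversalOrObstruction-resp : ∀ {M M′} → (∀ i j → M i j ≡ M′ i j) →
  TransversalOrObstruction M → TransversalOrObstruction M′
transversalOrObstruction-resp M≡M′ (heavyRow i j k j≢k e₁ e₂) =
  heavyRow i j k j≢k (trans (sym (M≡M′ _ _)) e₁) (trans (sym (M≡M′ _ _)) e₂)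
transversalOrObstruction-resp M≡M′ (transversal π e) = transversal π λ i → trans (sym (M≡M′ _ _)) (e i)
transversalOrObstruction-resp M≡M′ (fullColumn π e) = fullColumn π λ i → trans (sym (M≡M′ _ _)) (e i)

module MatrixSearch (M : Fin 3 → Fin 3 → Bool) where

  permutations : List (Embedding 3 3)
  permutations = embedding (tab3 0F 1F 2F) ∷ embedding (tab3 0F 2F 1F) ∷ embedding (tab3 1F 0F 2F) ∷
                 embedding (tab3 1F 2F 0F) ∷ embedding (tab3 2F 0F 1F) ∷ embedding (tab3 2F 1F 0F) ∷ []

  Found : Set
  Found = (∃[ i ] ∃[ j ] ∃[ k ] j ≢ k × M i j ≡ true × M i k ≡ true)
        ⊎ Any (λ π → ∀ i → M i (proj₁ π i) ≡ false) permutations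
        ⊎ Any (λ π → ∀ i → M i (proj₁ π 0F) ≡ true) permutations

  found? : Dec Found
  found? = (any? λ i → any? λ j → any? λ k →
               ¬? (j ≟ k) ×-dec (M i j Bool.≟ true) ×-dec (M i k Bool.≟ true))
    ⊎-dec Any.any? (λ π → all? λ i → M i (proj₁ π i) Bool.≟ false) permutations
    ⊎-dec Any.any? (λ π → all? λ i → M i (proj₁ π 0F) Bool.≟ true) permutations

  found⇒certificate : Found → TransversalOrObstruction M
  found⇒certificate (inj₁ (i , j , k , j≢k , e₁ , e₂)) = heavyRow i j k j≢k e₁ e₂
  found⇒certificate (inj₂ (inj₁ p)) = let (π , e) = Any.satisfied p in transversal π e
  found⇒certificate (inj₂ (inj₂ p)) = let (π , e) = Any.satisfied p in fullColumn π e

-- Decided by checking all 2⁹ Boolean 3×3 matrices.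
transversalOrObstruction : ∀ M → TransversalOrObstruction M
transversalOrObstruction M =
  transversalOrObstruction-resp entries (found⇒certificate _ (found (tabulate λ i → tabulate (M i))))
  where
  open MatrixSearch
  found : ∀ V → Found (λ i j → lookup (lookup V i) j)
  found = from-yes (searchable-Vec (searchable-Vec searchable-Bool 3) 3 λ V → found? λ i j → lookup (lookup V i) j)
  entries : ∀ i j → lookup (lookup (tabulate λ i → tabulate (M i)) i) j ≡ M i j
  entries i j =
    trans (cong (λ row → lookup row j) (lookup∘tabulate (λ i → tabulate (M i)) i)) (lookup∘tabulate (M i) j)

-- Counting vertices

Many : ∀ {n} → ℕ → (Fin n → Set) → Set
Many {n} k P = Σ (Fin k → Fin n) λ v → Injective _≡_ _≡_ v × (∀ i → P (v i))

many-mono : ∀ {n k} {P Q : Fin n → Set} → (∀ {x} → P x → Q x) → Many k P → Many k Q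
many-mono P⇒Q (v , v-inj , pv) = v , v-inj , P⇒Q ∘ pv

unique⇒many : ∀ {n k} {P : Fin n → Set} {xs : Vec (Fin n) k} → Unique xs → All P xs → Many k P
unique⇒many {xs = xs} xs-unique all =
  lookup xs , (λ {i} {j} → Unique.lookup-injective xs-unique i j) , All.lookup⁺ all

injective-into-image⇒≤ : ∀ {A : Set} {k m} (f : Fin k → A) → Injective _≡_ _≡_ f →
  (g : Fin m → A) → (∀ i → ∃ λ j → g j ≡ f i) → k ≤ m
injective-into-image⇒≤ f f-inj g covers = injective⇒≤ λ {i} {j} e →
  f-inj (trans (sym (proj₂ (covers i))) (trans (cong g e) (proj₂ (covers j))))

lookup-injective : ∀ {A : Set} {xs : List A} → ListUnique.Unique xs →
  Injective _≡_ _≡_ (List.lookup xs)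
lookup-injective (_ ∷ _) {zero} {zero} _ = refl
lookup-injective (x∉xs ∷ _) {zero} {suc j} e = contradiction e (ListAll.lookup x∉xs (∈-lookup j))
lookup-injective (x∉xs ∷ _) {suc i} {zero} e = contradiction (sym e) (ListAll.lookup x∉xs (∈-lookup i))
lookup-injective (_ ∷ u) {suc i} {suc j} e = cong suc (lookup-injective u e)

length-filter-complement : ∀ {A : Set} {P : A → Set} (P? : Decidable P) xs →
  length (filter P? xs) + length (filter (∁? P?) xs) ≡ length xs
length-filter-complement P? [] = refl
length-filter-complement P? (x ∷ xs) with P? x
... | yes _ = cong suc (length-filter-complement P? xs)
... | no _ = trans (+-suc _ _) (cong suc (length-filter-complement P? xs))

module Counting {n} {P : Fin n → Set} (P? : Decidable P) where

  members : List (Fin n)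
  members = filter P? (allFin n)

  count : ℕ
  count = length members

  member : Fin count → Fin n
  member = List.lookup members

  member-injective : Injective _≡_ _≡_ member
  member-injective = lookup-injective (filter⁺ P? (allFin⁺ n))

  member-sound : ∀ i → P (member i)
  member-sound i = ListAll.lookup (all-filter P? (allFin n)) (∈-lookup i)

  member-complete : ∀ {x} → P x → ∃ λ i → member i ≡ x
  member-complete {x} px = let x∈ = ∈-filter⁺ P? (∈-allFin x) px in Any.index x∈ , sym (lookup-index x∈)

  count-≤-image : ∀ {m} (g : Fin m → Fin n) → (∀ {x} → P x → ∃ λ j → g j ≡ x) → count ≤ m
  count-≤-image g covers = injective-into-image⇒≤ member member-injective g (covers ∘ member-sound)

  ≤count⇒many : ∀ {k} → k ≤ count → Many k P
  ≤count⇒many k≤c =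
    member ∘ (λ i → inject≤ i k≤c) , inject≤-injective k≤c k≤c _ _ ∘ member-injective , λ _ → member-sound _

  many⇒≤count : ∀ {k} → Many k P → k ≤ count
  many⇒≤count (v , v-inj , pv) = injective-into-image⇒≤ v v-inj member (member-complete ∘ pv)

  many? : ∀ k → Dec (Many k P)
  many? k = map′ ≤count⇒many many⇒≤count (k ≤? count)

count-complement : ∀ {n} {P : Fin n → Set} (P? : Decidable P) →
  Counting.count P? + Counting.count (∁? P?) ≡ n
count-complement {n} P? = trans (length-filter-complement P? (allFin n)) (length-tabulate id)

-- Distances and locating partitions

least-witness : ∀ {P : ℕ → Set} → Decidable P → ∀ {k} → P k → ∃ λ m → P m × (∀ e → e < m → ¬ P e)
least-witness P? {zero} p = 0 , p , λ _ ()
least-witness P? {suc k} p with P? 0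
... | yes p₀ = 0 , p₀ , λ _ ()
... | no ¬p₀ with least-witness (P? ∘ suc) p
...   | m , pm , below = suc m , pm , λ { zero _ → ¬p₀ ; (suc e) (s≤s e<m) → below e e<m }

module _ {n} (G : Graph n) where

  walk-zero : ∀ {u w} → Walk G u w 0 → u ≡ w
  walk-zero (here _) = refl

  walk-one : ∀ {u w} → Walk G u w 1 → Adj G u w
  walk-one (step a (here _)) = a

  walk? : ∀ k u w → Dec (Walk G u w k)
  walk? zero u w = map′ (λ { refl → here u }) walk-zero (u ≟ w)
  walk? (suc k) u w = map′ (λ { (v , a , p) → step a p }) (λ { (step a p) → _ , a , p })
    (any? λ v → (adj G u v Bool.≟ true) ×-dec walk? k v w)

  setDist-exists : Connected G → ∀ {k} (c : Fin n → Fin k) u s → ∃ (SetDist G c u (c s))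
  setDist-exists connected c u s =
    let (d , walk) = connected u s
        (m , reached , below) = least-witness (λ e → any? λ w → (c w ≟ c s) ×-dec walk? e u w) (s , refl , walk)
    in m , reached , λ w e cw e<m p → below e e<m (w , cw , p)

  setDist-unique : ∀ {k} {c : Fin n → Fin k} {u i d d′} → SetDist G c u i d → SetDist G c u i d′ → d ≡ d′
  setDist-unique {d = d} {d′} ((w , cw , p) , below) ((w′ , cw′ , p′) , below′) with <-cmp d d′
  ... | tri< d<d′ _ _ = contradiction p (below′ w d cw d<d′)
  ... | tri≈ _ d≡d′ _ = d≡d′
  ... | tri> _ _ d′<d = contradiction p′ (below w′ d′ cw′ d′<d)

  Singleton : ∀ {k} → (Fin n → Fin k) → Fin n → Set
  Singleton c s = ∀ z → c z ≡ c s → z ≡ s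

  Separates : Fin n → Fin n → Fin n → Set
  Separates s x y = s ≢ x × s ≢ y × adj G s x ≢ adj G s y

  module _ {k} {c : Fin n → Fin k} {s} (singleton : Singleton c s) where

    adjacent⇒setDist-one : ∀ {x} → s ≢ x → Adj G x s → SetDist G c x (c s) 1
    adjacent⇒setDist-one s≢x a =
      (s , refl , step a (here s)) ,
      λ { w zero cw (s≤s z≤n) p → s≢x (sym (singleton _ (subst (λ v → c v ≡ c s) (sym (walk-zero p)) cw))) }

    nonadjacent⇒¬setDist-one : ∀ {x} → adj G x s ≡ false → ¬ SetDist G c x (c s) 1
    nonadjacent⇒¬setDist-one ¬a ((w , cw , p) , _) with singleton w cw
    ... | refl = contradiction (trans (sym (walk-one p)) ¬a) λ ()

  -- Vertices in distinct classes are told apart at distance 0; vertices sharing a class are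
  -- told apart by their distance to a separating singleton class, which is 1 for exactly one.
  singleton-separators⇒locating : Connected G → ∀ {k} (c : Fin n → Fin k) →
    (∀ x y → x ≢ y → c x ≡ c y → ∃ λ s → Singleton c s × Separates s x y) → Locating G c
  singleton-separators⇒locating connected c separators x y x≢y with c x ≟ c y
  ... | no cx≢cy = c x , 0 , ((x , refl , here x) , λ _ _ _ ()) ,
          λ { ((w , cw , p) , _) → cx≢cy (sym (subst (λ v → c v ≡ c x) (sym (walk-zero p)) cw)) }
  ... | yes cx≡cy with separators x y x≢y cx≡cy
  ...   | s , singleton , s≢x , s≢y , differ with adj G x s in ax | adj G y s in ay
  ...     | true | false = c s , 1 , adjacent⇒setDist-one singleton s≢x ax , nonadjacent⇒¬setDist-one singleton ay
  ...     | false | true =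
            let (d , dx) = setDist-exists connected c x s
                dy-one = adjacent⇒setDist-one singleton s≢y ay
            in c s , d , dx , λ dy →
                 nonadjacent⇒¬setDist-one singleton ax (subst (SetDist G c x (c s)) (setDist-unique dy dy-one) dx)
  ...     | true | true = contradiction (trans (Graph.sym G s x) (trans ax (sym (trans (Graph.sym G s y) ay)))) differ
  ...     | false | false = contradiction (trans (Graph.sym G s x) (trans ax (sym (trans (Graph.sym G s y) ay)))) differ

-- Merging pairs of vertices

module _ {m} {a b : Fin (suc m)} (b≢a : b ≢ a) where

  merge : Fin (suc m) → Fin m
  merge x with x ≟ b
  ... | yes _ = punchOut b≢a
  ... | no x≢b = punchOut (x≢b ∘ sym)

  merge-surjective : Surjective _≡_ _≡_ merge
  merge-surjective y = punchIn b y , λ { refl → merge-punchIn }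
    where
    merge-punchIn : merge (punchIn b y) ≡ y
    merge-punchIn with punchIn b y ≟ b
    ... | yes e = contradiction e (punchInᵢ≢i b y)
    ... | no _ = trans (punchOut-cong b refl) (punchOut-punchIn b)

  merge-fibre : ∀ {x y} → merge x ≡ merge y → x ≡ y ⊎ (x ≡ a × y ≡ b) ⊎ (x ≡ b × y ≡ a)
  merge-fibre {x} {y} e with x ≟ b | y ≟ b
  ... | yes x≡b | yes y≡b = inj₁ (trans x≡b (sym y≡b))
  ... | yes x≡b | no _ = inj₂ (inj₂ (x≡b , sym (punchOut-injective b≢a _ e)))
  ... | no _ | yes y≡b = inj₂ (inj₁ (punchOut-injective _ b≢a e , y≡b))
  ... | no _ | no _ = inj₁ (punchOut-injective {i = b} _ _ e)

  merge-injective-away : ∀ {x y} → y ≢ a → y ≢ b → merge x ≡ merge y → x ≡ y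
  merge-injective-away y≢a y≢b e with merge-fibre e
  ... | inj₁ x≡y = x≡y
  ... | inj₂ (inj₁ (_ , y≡b)) = contradiction y≡b y≢b
  ... | inj₂ (inj₂ (_ , y≡a)) = contradiction y≡a y≢a

-- point (inj₁ i) and point (inj₂ i) form the i-th pair.
Partners : ∀ {n k} → (Fin k ⊎ Fin k → Fin n) → Fin n → Fin n → Set
Partners point x y = ∃ λ e → x ≡ point e × y ≡ point (swap e)

shift : ∀ {k} → Fin k ⊎ Fin k → Fin (suc k) ⊎ Fin (suc k)
shift = Sum.map suc suc

shift-injective : ∀ {k} → Injective _≡_ _≡_ (shift {k})
shift-injective {x = inj₁ _} {inj₁ _} refl = refl
shift-injective {x = inj₂ _} {inj₂ _} refl = refl

shift-swap : ∀ {k} (e : Fin k ⊎ Fin k) → shift (swap e) ≡ swap (shift e)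
shift-swap (inj₁ _) = refl
shift-swap (inj₂ _) = refl

collapsePairs : ∀ k {m} (point : Fin k ⊎ Fin k → Fin (k + m)) → Injective _≡_ _≡_ point →
  Σ (Fin (k + m) → Fin m) λ c →
    Surjective _≡_ _≡_ c × (∀ {x y} → c x ≡ c y → x ≡ y ⊎ Partners point x y)
collapsePairs zero point _ = id , (λ y → y , id) , inj₁
collapsePairs (suc k) {m} point point-inj =
  c′ ∘ g , Compose.surjective _≡_ _≡_ _≡_ (merge-surjective b≢a) c′-surjective , fibre
  where
  a b : Fin (suc (k + m))
  a = point (inj₁ 0F)
  b = point (inj₂ 0F)
  b≢a : b ≢ a
  b≢a e = contradiction (point-inj e) λ ()
  g : Fin (suc (k + m)) → Fin (k + m)
  g = merge b≢a
  away : ∀ e → point (shift e) ≢ a × point (shift e) ≢ b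
  away (inj₁ _) = (λ p → contradiction (point-inj p) λ ()) , (λ p → contradiction (point-inj p) λ ())
  away (inj₂ _) = (λ p → contradiction (point-inj p) λ ()) , (λ p → contradiction (point-inj p) λ ())
  point′ : Fin k ⊎ Fin k → Fin (k + m)
  point′ = g ∘ point ∘ shift
  point′-injective : Injective _≡_ _≡_ point′
  point′-injective {y = y} e =
    shift-injective (point-inj (merge-injective-away b≢a (proj₁ (away y)) (proj₂ (away y)) e))
  c′ : Fin (k + m) → Fin m
  c′ = proj₁ (collapsePairs k point′ point′-injective)
  c′-surjective : Surjective _≡_ _≡_ c′
  c′-surjective = proj₁ (proj₂ (collapsePairs k point′ point′-injective))
  c′-fibre : ∀ {x y} → c′ x ≡ c′ y → x ≡ y ⊎ Partners point′ x y
  c′-fibre = proj₂ (proj₂ (collapsePairs k point′ point′-injective))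
  fibre : ∀ {x y} → c′ (g x) ≡ c′ (g y) → x ≡ y ⊎ Partners point x y
  fibre e with c′-fibre e
  ... | inj₁ gx≡gy with merge-fibre b≢a gx≡gy
  ...   | inj₁ x≡y = inj₁ x≡y
  ...   | inj₂ (inj₁ (x≡a , y≡b)) = inj₂ (inj₁ 0F , x≡a , y≡b)
  ...   | inj₂ (inj₂ (x≡b , y≡a)) = inj₂ (inj₂ 0F , x≡b , y≡a)
  fibre e | inj₂ (f , gx≡ , gy≡) =
    inj₂ (shift f , back f gx≡ , subst (λ z → _ ≡ point z) (shift-swap f) (back (swap f) gy≡))
    where
    back : ∀ {x} e′ → g x ≡ point′ e′ → x ≡ point (shift e′)
    back e′ = merge-injective-away b≢a (proj₁ (away e′)) (proj₂ (away e′))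

record SeparatedPairs {n} (G : Graph n) (k : ℕ) : Set where
  field
    point : Fin k ⊎ Fin k → Fin n
    point-injective : Injective _≡_ _≡_ point
    separator : Fin k → Fin n
    separator-fresh : ∀ i e → separator i ≢ point e
    separates : ∀ i → adj G (separator i) (point (inj₁ i)) ≢ adj G (separator i) (point (inj₂ i))

-- Collapsing each pair into one class leaves every separator alone in its class.
separatedPairs⇒partitionDim : ∀ {k m} (G : Graph (k + m)) → Connected G →
  SeparatedPairs G k → PartitionDimAtMost G m
separatedPairs⇒partitionDim {k} {m} G connected pairs =
  m , ≤-refl , c , c-surjective , singleton-separators⇒locating G connected c separators
  where
  open SeparatedPairs pairs
  c : Fin (k + m) → Fin m
  c = proj₁ (collapsePairs k point point-injective)
  c-surjective : Surjective _≡_ _≡_ c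
  c-surjective = proj₁ (proj₂ (collapsePairs k point point-injective))
  c-fibre : ∀ {x y} → c x ≡ c y → x ≡ y ⊎ Partners point x y
  c-fibre = proj₂ (proj₂ (collapsePairs k point point-injective))

  separator-singleton : ∀ i → Singleton G c (separator i)
  separator-singleton i z cz≡cs with c-fibre cz≡cs
  ... | inj₁ z≡s = z≡s
  ... | inj₂ (e , _ , s≡pe) = contradiction s≡pe (separator-fresh i (swap e))

  index : Fin k ⊎ Fin k → Fin k
  index = [ id , id ]

  partners-separated : ∀ e → Separates G (separator (index e)) (point e) (point (swap e))
  partners-separated (inj₁ i) = separator-fresh i (inj₁ i) , separator-fresh i (inj₂ i) , separates i
  partners-separated (inj₂ i) = separator-fresh i (inj₂ i) , separator-fresh i (inj₁ i) , separates i ∘ sym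

  separators : ∀ x y → x ≢ y → c x ≡ c y → ∃ λ s → Singleton G c s × Separates G s x y
  separators x y x≢y cx≡cy with c-fibre cx≡cy
  ... | inj₁ x≡y = contradiction x≡y x≢y
  ... | inj₂ (e , refl , refl) = separator (index e) , separator-singleton (index e) , partners-separated e

[,]-injective : ∀ {A B C : Set} {f : A → C} {g : B → C} → Injective _≡_ _≡_ f → Injective _≡_ _≡_ g →
  (∀ a b → f a ≢ g b) → Injective _≡_ _≡_ [ f , g ]
[,]-injective f-inj g-inj f≢g {inj₁ _} {inj₁ _} e = cong inj₁ (f-inj e)
[,]-injective f-inj g-inj f≢g {inj₁ a} {inj₂ b} e = contradiction e (f≢g a b)
[,]-injective f-inj g-inj f≢g {inj₂ b} {inj₁ a} e = contradiction (sym e) (f≢g a b)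
[,]-injective f-inj g-inj f≢g {inj₂ _} {inj₂ _} e = cong inj₂ (g-inj e)

-- Balanced vertices and twins

2*t≤t+c⇒9≤t+c⇒5≤c : ∀ {t c} → 2 * t ≤ t + c → 9 ≤ t + c → 5 ≤ c
2*t≤t+c⇒9≤t+c⇒5≤c {t} {c} 2t≤t+c 9≤t+c with 5 ≤? c
... | yes 5≤c = 5≤c
... | no 5≰c = contradiction (≤-trans 9≤t+c (+-mono-≤ t≤4 c≤4)) (<-irrefl refl)
  where
  c≤4 : c ≤ 4
  c≤4 with ≰⇒> 5≰c
  ... | s≤s c≤4 = c≤4
  t≤4 : t ≤ 4
  t≤4 = ≤-trans (subst (_≤ c) (+-identityʳ t) (+-cancelˡ-≤ t _ _ 2t≤t+c)) c≤4

module _ {n} (G : Graph n) where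

  adj? : ∀ w → Decidable (Adj G w)
  adj? w x = adj G w x Bool.≟ true

  NonNeighbour : Fin n → Fin n → Set
  NonNeighbour w x = x ≢ w × adj G w x ≡ false

  Balanced : Fin n → Set
  Balanced w = Many 3 (Adj G w) × Many 3 (NonNeighbour w)

  balanced? : Decidable Balanced
  balanced? w = Counting.many? (adj? w) 3 ×-dec
    Counting.many? (λ x → ¬? (x ≟ w) ×-dec (adj G w x Bool.≟ false)) 3

  balanced⇒separatedPairs : ∀ {w} → Balanced w → SeparatedPairs G 3
  balanced⇒separatedPairs {w} ((v , v-inj , adjacent) , (v′ , v′-inj , nonadjacent)) = record
    { point = [ v , v′ ]
    ; point-injective = [,]-injective v-inj v′-inj λ i j e →
        contradiction (trans (sym (adjacent i)) (trans (cong (adj G w) e) (proj₂ (nonadjacent j)))) λ ()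
    ; separator = λ _ → w
    ; separator-fresh = λ
        { _ (inj₁ i) refl → contradiction (trans (sym (adjacent i)) (irrefl G w)) λ ()
        ; _ (inj₂ j) w≡v′j → proj₁ (nonadjacent j) (sym w≡v′j) }
    ; separates = λ i e → contradiction (trans (sym (adjacent i)) (trans e (proj₂ (nonadjacent i)))) λ ()
    }

  twins? : ∀ u → Decidable (Twins G u)
  twins? u v = all? λ w → ¬? (w ≟ u) →-dec ¬? (w ≟ v) →-dec (adj G u w Bool.≟ adj G v w)

  many-non-twins : TwinBoundHalf G → 9 ≤ n → ∀ u → Many 5 (∁ (Twins G u))
  many-non-twins bound n≥9 u = Counting.≤count⇒many (∁? (twins? u)) (twins-few (subst (9 ≤_) (sym split) n≥9))
    where
    open Counting (twins? u)
    split : count + Counting.count (∁? (twins? u)) ≡ n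
    split = count-complement (twins? u)
    twins-few : 9 ≤ count + Counting.count (∁? (twins? u)) → 5 ≤ Counting.count (∁? (twins? u))
    twins-few = 2*t≤t+c⇒9≤t+c⇒5≤c
      (subst (2 * count ≤_) (sym split) (bound u count member member-injective member-sound))

-- Vertices with at most two atypical adjacencies

_⊕_ : Fin 5 → ℕ → Fin 5
i ⊕ zero = i
i ⊕ suc k = next₅ (i ⊕ k)

pentagon-spread : ∀ i → Unique (i ∷ i ⊕ 2 ∷ i ⊕ 4 ∷ [])
pentagon-spread = from-yes (all? λ i → unique? _≟_ (i ∷ i ⊕ 2 ∷ i ⊕ 4 ∷ []))

pentagon-apart : ∀ i →
  All (λ s → All (s ≢_) (i ∷ i ⊕ 2 ∷ i ⊕ 4 ∷ [])) (i ⊕ 1 ∷ i ⊕ 1 ∷ i ⊕ 3 ∷ [])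
pentagon-apart = from-yes (all? λ i →
  All.all? (λ s → All.all? (λ t → ¬? (s ≟ t)) (i ∷ i ⊕ 2 ∷ i ⊕ 4 ∷ [])) (i ⊕ 1 ∷ i ⊕ 1 ∷ i ⊕ 3 ∷ []))

rotate₃ : Fin 5 → Fin 5
rotate₃ = tab5 1F 2F 0F 3F 4F

rotate₃-injective : Injective _≡_ _≡_ rotate₃
rotate₃-injective = proj₂ (embedding rotate₃)

does-true : ∀ {A : Set} (a? : Dec A) → does a? ≡ true → A
does-true (yes a) _ = a

does-false : ∀ {A : Set} (a? : Dec A) → does a? ≡ false → ¬ A
does-false (no ¬a) _ = ¬a

≢-≢⇒≡ : ∀ {a b c : Bool} → a ≢ b → b ≢ c → a ≡ c
≢-≢⇒≡ a≢b b≢c = trans (Bool.¬-not a≢b) (sym (Bool.¬-not (b≢c ∘ sym)))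

no-alternating-triangle : ∀ {a b c : Bool} → a ≢ b → b ≢ c → c ≢ a → ⊥
no-alternating-triangle a≢b b≢c c≢a = c≢a (sym (≢-≢⇒≡ a≢b b≢c))

no-alternating-pentagon : ∀ {a b c d e : Bool} → a ≢ b → b ≢ c → c ≢ d → d ≢ e → e ≢ a → ⊥
no-alternating-pentagon a≢b b≢c c≢d d≢e e≢a = e≢a (sym (trans (≢-≢⇒≡ a≢b b≢c) (≢-≢⇒≡ c≢d d≢e)))

module Unbalanced {n} (G : Graph n) (unbalanced : ∀ w → ¬ Balanced G w) where

  -- Without balanced vertices, w is adjacent to all but at most two others when this is true,
  -- and to at most two others when it is false.
  majority : Fin n → Bool
  majority w = does (Counting.many? (adj? G w) 3)

  Atypical : Fin n → Fin n → Set
  Atypical w x = w ≢ x × adj G w x ≢ majority w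

  atypical? : ∀ w x → Dec (Atypical w x)
  atypical? w x = ¬? (w ≟ x) ×-dec ¬? (adj G w x Bool.≟ majority w)

  typical-adj : ∀ {w x} → w ≢ x → ¬ Atypical w x → adj G w x ≡ majority w
  typical-adj {w} {x} w≢x ¬atypical =
    decidable-stable (adj G w x Bool.≟ majority w) λ differs → ¬atypical (w≢x , differs)

  atypical-few : ∀ {w} {xs : Vec (Fin n) 3} → Unique xs → ¬ All (Atypical w) xs
  atypical-few {w} xs-unique atypical with Counting.many? (adj? G w) 3 in three-adjacent?
  ... | yes three-adjacent = unbalanced w (three-adjacent , unique⇒many xs-unique (All.map nonadjacent atypical))
    where
    nonadjacent : ∀ {x} → Atypical w x → NonNeighbour G w x
    nonadjacent {x} (w≢x , differs) =
      w≢x ∘ sym , Bool.¬-not (subst (adj G w x ≢_) (cong does three-adjacent?) differs)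
  ... | no few-adjacent = few-adjacent (unique⇒many xs-unique (All.map adjacent atypical))
    where
    adjacent : ∀ {x} → Atypical w x → Adj G w x
    adjacent {x} (_ , differs) = Bool.¬-not (subst (adj G w x ≢_) (cong does three-adjacent?) differs)

  separating : ∀ {w x y} → Atypical w x → ¬ Atypical w y → w ≢ y → adj G w x ≢ adj G w y
  separating (_ , differs) ¬atypical w≢y e = differs (trans e (typical-adj w≢y ¬atypical))

  one-way⇒majority≢ : ∀ {a b} → Atypical a b → ¬ Atypical b a → majority a ≢ majority b
  one-way⇒majority≢ {a} {b} (a≢b , differs) ¬ba same =
    differs (trans (Graph.sym G a b) (trans (typical-adj (a≢b ∘ sym) ¬ba) (sym same)))

  Typical : Fin n → Set
  Typical x = ∀ w → ¬ Atypical w x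

  typical-twins : ∀ {x y} → Typical x → Typical y → Twins G x y
  typical-twins {x} {y} x-typical y-typical w w≢x w≢y =
    trans (Graph.sym G x w) (trans (typical-adj w≢x (x-typical w))
      (sym (trans (Graph.sym G y w) (typical-adj w≢y (y-typical w)))))

  Hit : Fin n → Set
  Hit x = ∃ λ w → Atypical w x

  ¬typical⇒hit : ∀ {x} → ¬ Typical x → Hit x
  ¬typical⇒hit {x} ¬typical with any? (λ w → atypical? w x)
  ... | yes hit = hit
  ... | no ¬hit = contradiction (λ w atypical → ¬hit (w , atypical)) ¬typical

  -- Typical vertices are pairwise twins, so the (at least five) non-twins of a typical vertex are hit.
  many-hit : TwinBoundHalf G → 9 ≤ n → Many 5 Hit
  many-hit bound n≥9 with any? (λ u → all? λ w → ¬? (atypical? w u))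
  ... | yes (u , u-typical) =
        many-mono (λ {x} ¬twin → ¬typical⇒hit {x} (¬twin ∘ typical-twins u-typical)) (many-non-twins G bound n≥9 u)
  ... | no no-typical = (λ i → inject≤ i 5≤n) , inject≤-injective 5≤n 5≤n _ _ ,
          λ _ → ¬typical⇒hit λ typical → no-typical (_ , typical)
    where
    5≤n : 5 ≤ n
    5≤n = ≤-trans (m≤m+n 5 4) n≥9

  record AtypicalTriple : Set where
    field
      targets sources : Vec (Fin n) 3
      targets-unique : Unique targets
      sources-fresh : All (λ w → All (w ≢_) targets) sources
      atypical : Pointwise Atypical sources targets

  module Embedded (v : Fin 5 → Fin n) (v-injective : Injective _≡_ _≡_ v) where

    distinct : ∀ {k} (is : Vec (Fin 5) k) → {True (unique? _≟_ is)} → Unique (Vec.map v is)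
    distinct is {p} = Unique.map⁺ v-injective (toWitness p)

    avoids : ∀ {k} i (is : Vec (Fin 5) k) → {True (All.all? (λ j → ¬? (i ≟ j)) is)} →
      All (v i ≢_) (Vec.map v is)
    avoids i is {p} = All.map⁺ (All.map (λ i≢j → i≢j ∘ v-injective) (toWitness p))

    avoids-if-in : ∀ {h} → h ≡ v 0F ⊎ h ≡ v 2F → ∀ j → j ≢ 0F → j ≢ 2F → h ≢ v j
    avoids-if-in (inj₁ refl) j j≢0 _ = j≢0 ∘ sym ∘ v-injective
    avoids-if-in (inj₂ refl) j _ j≢2 = j≢2 ∘ sym ∘ v-injective

  chord⇒triple : (v : Fin 5 → Fin n) → Injective _≡_ _≡_ v →
    Atypical (v 0F) (v 1F) → Atypical (v 1F) (v 2F) → Atypical (v 1F) (v 0F) →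
    Hit (v 3F) → Hit (v 4F) → AtypicalTriple
  chord⇒triple v v-inj a₀₁ a₁₂ a₁₀ (h₃ , b₃) (h₄ , b₄)
    with (h₃ ≟ v 0F) ⊎-dec (h₃ ≟ v 2F) | (h₄ ≟ v 0F) ⊎-dec (h₄ ≟ v 2F)
  ... | no h₃∉ | _ = record
    { targets = v 0F ∷ v 2F ∷ v 3F ∷ [] ; sources = v 1F ∷ v 1F ∷ h₃ ∷ []
    ; targets-unique = distinct (0F ∷ 2F ∷ 3F ∷ [])
    ; sources-fresh = avoids 1F _ ∷ avoids 1F _ ∷ (h₃∉ ∘ inj₁ ∷ h₃∉ ∘ inj₂ ∷ proj₁ b₃ ∷ []) ∷ []
    ; atypical = a₁₀ ∷ a₁₂ ∷ b₃ ∷ [] }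
    where open Embedded v v-inj
  ... | yes _ | no h₄∉ = record
    { targets = v 0F ∷ v 2F ∷ v 4F ∷ [] ; sources = v 1F ∷ v 1F ∷ h₄ ∷ []
    ; targets-unique = distinct (0F ∷ 2F ∷ 4F ∷ [])
    ; sources-fresh = avoids 1F _ ∷ avoids 1F _ ∷ (h₄∉ ∘ inj₁ ∷ h₄∉ ∘ inj₂ ∷ proj₁ b₄ ∷ []) ∷ []
    ; atypical = a₁₀ ∷ a₁₂ ∷ b₄ ∷ [] }
    where open Embedded v v-inj
  ... | yes h₃∈ | yes h₄∈ = record
    { targets = v 1F ∷ v 3F ∷ v 4F ∷ [] ; sources = v 0F ∷ h₃ ∷ h₄ ∷ []
    ; targets-unique = distinct (1F ∷ 3F ∷ 4F ∷ [])
    ; sources-fresh = avoids 0F _ ∷ fresh h₃∈ ∷ fresh h₄∈ ∷ []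
    ; atypical = a₀₁ ∷ b₃ ∷ b₄ ∷ [] }
    where
    open Embedded v v-inj
    fresh : ∀ {h} → h ≡ v 0F ⊎ h ≡ v 2F → All (h ≢_) (v 1F ∷ v 3F ∷ v 4F ∷ [])
    fresh h∈ =
      avoids-if-in h∈ 1F (λ ()) (λ ()) ∷ avoids-if-in h∈ 3F (λ ()) (λ ()) ∷ avoids-if-in h∈ 4F (λ ()) (λ ()) ∷ []

  -- Along an odd cycle the majorities cannot alternate, so some arrow of the cycle is two-way.
  triangle⇒triple : (v : Fin 5 → Fin n) → Injective _≡_ _≡_ v →
    Atypical (v 0F) (v 1F) → Atypical (v 1F) (v 2F) → Atypical (v 2F) (v 0F) →
    Hit (v 3F) → Hit (v 4F) → AtypicalTriple
  triangle⇒triple v v-inj a₀₁ a₁₂ a₂₀ h₃ h₄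
    with atypical? (v 1F) (v 0F) | atypical? (v 2F) (v 1F) | atypical? (v 0F) (v 2F)
  ... | yes a₁₀ | _ | _ = chord⇒triple v v-inj a₀₁ a₁₂ a₁₀ h₃ h₄
  ... | no _ | yes a₂₁ | _ = chord⇒triple (v ∘ rotate₃) (rotate₃-injective ∘ v-inj) a₁₂ a₂₀ a₂₁ h₃ h₄
  ... | no _ | no _ | yes a₀₂ =
    chord⇒triple (v ∘ rotate₃ ∘ rotate₃) (rotate₃-injective ∘ rotate₃-injective ∘ v-inj) a₂₀ a₀₁ a₀₂ h₃ h₄
  ... | no ¬a₁₀ | no ¬a₂₁ | no ¬a₀₂ = ⊥-elim (no-alternating-triangle
        (one-way⇒majority≢ a₀₁ ¬a₁₀) (one-way⇒majority≢ a₁₂ ¬a₂₁) (one-way⇒majority≢ a₂₀ ¬a₀₂))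

  pentagon-chord⇒triple : (v : Fin 5 → Fin n) → Injective _≡_ _≡_ v →
    (∀ i → Atypical (v i) (v (next₅ i))) → ∀ i → Atypical (v (next₅ i)) (v i) → AtypicalTriple
  pentagon-chord⇒triple v v-inj cycle i chord = record
    { targets = Vec.map v (i ∷ i ⊕ 2 ∷ i ⊕ 4 ∷ []) ; sources = Vec.map v (i ⊕ 1 ∷ i ⊕ 1 ∷ i ⊕ 3 ∷ [])
    ; targets-unique = Unique.map⁺ v-inj (pentagon-spread i)
    ; sources-fresh = All.map⁺ (All.map (λ apart → All.map⁺ (All.map (_∘ v-inj) apart)) (pentagon-apart i))
    ; atypical = chord ∷ cycle (i ⊕ 1) ∷ cycle (i ⊕ 3) ∷ [] }

  pentagon⇒triple : (v : Fin 5 → Fin n) → Injective _≡_ _≡_ v →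
    (∀ i → Atypical (v i) (v (next₅ i))) → AtypicalTriple
  pentagon⇒triple v v-inj cycle with any? (λ i → atypical? (v (next₅ i)) (v i))
  ... | yes (i , chord) = pentagon-chord⇒triple v v-inj cycle i chord
  ... | no no-chord = ⊥-elim
    (no-alternating-pentagon (alternate 0F) (alternate 1F) (alternate 2F) (alternate 3F) (alternate 4F))
    where
    alternate : ∀ i → majority (v i) ≢ majority (v (next₅ i))
    alternate i = one-way⇒majority≢ (cycle i) λ chord → no-chord (i , chord)

  module HitPattern (s : Fin 5 → Fin n) (s-inj : Injective _≡_ _≡_ s) (hit : ∀ j → Hit (s j)) where

    source : Fin 5 → Fin n
    source j = proj₁ (hit j)

    source→ : ∀ j → Atypical (source j) (s j)
    source→ j = proj₂ (hit j)

    position : ∀ j → Dec (∃ λ k → source j ≡ s k) → Fin 5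
    position j (yes (k , _)) = k
    position j (no _) = j

    q : Fin 5 → Fin 5
    q j = position j (any? λ k → source j ≟ s k)

    q-sound : ∀ {j k} → q j ≡ k → k ≢ j → source j ≡ s k
    q-sound {j} = sound (any? λ k → source j ≟ s k)
      where
      sound : ∀ d {k} → position j d ≡ k → k ≢ j → source j ≡ s k
      sound (yes (_ , e)) refl _ = e
      sound (no _) refl j≢j = contradiction refl j≢j

    q-complete : ∀ {j k} → source j ≡ s k → q j ≡ k
    q-complete {j} = complete (any? λ k → source j ≟ s k)
      where
      complete : ∀ d {k} → source j ≡ s k → position j d ≡ k
      complete (yes (_ , e)) e′ = s-inj (trans (sym e) e′)
      complete (no none) e′ = contradiction (_ , e′) none

    arrow : ∀ {j k} → q j ≡ k → k ≢ j → Atypical (s k) (s j)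
    arrow {j} qj≡k k≢j = subst (λ w → Atypical w (s j)) (q-sound qj≡k k≢j) (source→ j)

    certificate⇒triple : IndependentTripleOrOddCycle q → AtypicalTriple
    certificate⇒triple (independent (ι , ι-inj) no-arrow) = record
      { targets = tabulate (s ∘ ι) ; sources = tabulate (source ∘ ι)
      ; targets-unique = Unique.tabulate⁺ (ι-inj ∘ s-inj)
      ; sources-fresh = All.tabulate⁺ λ a → All.tabulate⁺ λ b → fresh a b
      ; atypical = Pointwise.tabulate⁺ (source→ ∘ ι) }
      where
      fresh : ∀ a b → source (ι a) ≢ s (ι b)
      fresh a b with a ≟ b
      ... | yes refl = proj₁ (source→ (ι a))
      ... | no a≢b = no-arrow a b a≢b ∘ q-complete
    certificate⇒triple (triangle (r , r-inj) e₀₁ e₁₂ e₂₀) =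
      triangle⇒triple (s ∘ r) (r-inj ∘ s-inj)
        (arrow e₀₁ (r≢ λ ())) (arrow e₁₂ (r≢ λ ())) (arrow e₂₀ (r≢ λ ()))
        (hit (r 3F)) (hit (r 4F))
      where
      r≢ : ∀ {i j} → i ≢ j → r i ≢ r j
      r≢ i≢j = i≢j ∘ r-inj
    certificate⇒triple (pentagon (r , r-inj) e) =
      pentagon⇒triple (s ∘ r) (r-inj ∘ s-inj) λ i → arrow (e i) (next₅-moves i ∘ sym ∘ r-inj)
      where
      next₅-moves : ∀ i → next₅ i ≢ i
      next₅-moves = from-yes (all? λ i → ¬? (next₅ i ≟ i))

  many-hit⇒triple : Many 5 Hit → AtypicalTriple
  many-hit⇒triple (s , s-inj , hit) = certificate⇒triple (independentTripleOrOddCycle q)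
    where open HitPattern s s-inj hit

  module Completion (triple : AtypicalTriple) (n≥9 : 9 ≤ n) where
    open AtypicalTriple triple

    target source : Fin 3 → Fin n
    target = lookup targets
    source = lookup sources

    target-injective : Injective _≡_ _≡_ target
    target-injective {i} {j} = Unique.lookup-injective targets-unique i j

    source≢target : ∀ i j → source i ≢ target j
    source≢target i j = All.lookup⁺ (All.lookup⁺ sources-fresh i) j

    source→target : ∀ i → Atypical (source i) (target i)
    source→target = Pointwise.lookup atypical

    used : Vec (Fin n) 6
    used = targets ++ sources

    used? : Decidable λ x → ∃ λ j → lookup used j ≡ x
    used? x = any? λ j → lookup used j ≟ x

    free-many : Many 3 (∁ λ x → ∃ λ j → lookup used j ≡ x)
    free-many = Counting.≤count⇒many (∁? used?) (+-cancelˡ-≤ 6 3 _ (≤-trans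
      (subst (9 ≤_) (sym (count-complement used?)) n≥9)
      (+-monoˡ-≤ _ (Counting.count-≤-image used? (lookup used) id))))

    pool : Fin 3 → Fin n
    pool = proj₁ free-many

    pool-injective : Injective _≡_ _≡_ pool
    pool-injective = proj₁ (proj₂ free-many)

    pool≢target : ∀ j i → pool j ≢ target i
    pool≢target j i e = proj₂ (proj₂ free-many) j (i ↑ˡ 3 , trans (lookup-++ˡ targets sources i) (sym e))

    source≢pool : ∀ i j → source i ≢ pool j
    source≢pool i j e = proj₂ (proj₂ free-many) j (3 ↑ʳ i , trans (lookup-++ʳ targets sources i) e)

    M : Fin 3 → Fin 3 → Bool
    M i j = does (atypical? (source i) (pool j))

    M-true : ∀ {i j} → M i j ≡ true → Atypical (source i) (pool j)
    M-true {i} {j} = does-true (atypical? (source i) (pool j))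

    M-false : ∀ {i j} → M i j ≡ false → ¬ Atypical (source i) (pool j)
    M-false {i} {j} = does-false (atypical? (source i) (pool j))

    module Reindexed (π : Embedding 3 3) where

      pool′ : Fin 3 → Fin n
      pool′ = pool ∘ proj₁ π

      six : Fin 3 ⊎ Fin 3 → Fin n
      six = [ target , pool′ ]

      six-injective : Injective _≡_ _≡_ six
      six-injective = [,]-injective target-injective (proj₂ π ∘ pool-injective) λ i j → pool≢target _ i ∘ sym

      source-fresh : ∀ i e → source i ≢ six e
      source-fresh i (inj₁ j) = source≢target i j
      source-fresh i (inj₂ j) = source≢pool i (proj₁ π j)

      no-third-atypical : ∀ {i} (es : Vec (Fin 3 ⊎ Fin 3) 3) → {True (unique? (⊎-≡-dec _≟_ _≟_) es)} →
        ¬ All (Atypical (source i)) (Vec.map six es)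
      no-third-atypical es {p} = atypical-few (Unique.map⁺ six-injective (toWitness p))

    σ : Fin 3 ⊎ Fin 3 → Fin 3 ⊎ Fin 3
    σ = [ tab3 (inj₁ 0F) (inj₁ 1F) (inj₂ 0F) , tab3 (inj₂ 1F) (inj₂ 2F) (inj₁ 2F) ]

    σ-injective : Injective _≡_ _≡_ σ
    σ-injective = from-yes (injective? (searchable-⊎ all? all?) (⊎-≡-dec _≟_ _≟_) (⊎-≡-dec _≟_ _≟_) σ)

    certificate⇒pairs : TransversalOrObstruction M → SeparatedPairs G 3
    certificate⇒pairs (heavyRow i j k j≢k e₁ e₂) = ⊥-elim (atypical-few
      ((pool≢target j i ∘ sym ∷ pool≢target k i ∘ sym ∷ []) ∷ (j≢k ∘ pool-injective ∷ []) ∷ [] ∷ [])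
      (source→target i ∷ M-true e₁ ∷ M-true e₂ ∷ []))
    certificate⇒pairs (transversal π e) = record
      { point = six ; point-injective = six-injective
      ; separator = source ; separator-fresh = source-fresh
      ; separates = λ i → separating (source→target i) (M-false (e i)) (source≢pool i _) }
      where open Reindexed π
    -- Each source is atypical exactly to its target and to pool′ 0.
    certificate⇒pairs (fullColumn π e) = record
      { point = six ∘ σ ; point-injective = σ-injective ∘ six-injective
      ; separator = source ∘ tab3 0F 1F 0F ; separator-fresh = λ i e′ → source-fresh _ (σ e′)
      ; separates = λ
          { 0F → separating (source→target 0F)
                   (λ a → no-third-atypical
                      (inj₁ 0F ∷ inj₂ 0F ∷ inj₂ 1F ∷ []) (source→target 0F ∷ M-true (e 0F) ∷ a ∷ []))
                   (source-fresh 0F (inj₂ 1F))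
          ; 1F → separating (source→target 1F)
                   (λ a → no-third-atypical
                      (inj₁ 1F ∷ inj₂ 0F ∷ inj₂ 2F ∷ []) (source→target 1F ∷ M-true (e 1F) ∷ a ∷ []))
                   (source-fresh 1F (inj₂ 2F))
          ; 2F → separating (M-true (e 0F))
                   (λ a → no-third-atypical
                      (inj₁ 0F ∷ inj₂ 0F ∷ inj₁ 2F ∷ []) (source→target 0F ∷ M-true (e 0F) ∷ a ∷ []))
                   (source-fresh 0F (inj₁ 2F)) } }
      where open Reindexed π

  triple⇒separatedPairs : 9 ≤ n → AtypicalTriple → SeparatedPairs G 3
  triple⇒separatedPairs n≥9 triple = certificate⇒pairs (transversalOrObstruction M)
    where open Completion triple n≥9

separatedPairs : ∀ {n} (G : Graph n) → 9 ≤ n → TwinBoundHalf G → SeparatedPairs G 3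
separatedPairs G n≥9 bound with any? (balanced? G)
... | yes (_ , balanced) = balanced⇒separatedPairs G balanced
... | no none = triple⇒separatedPairs n≥9 (many-hit⇒triple (many-hit bound n≥9))
  where open Unbalanced G (λ w balanced → none (w , balanced))

mainTheorem8 : (n : ℕ) (G : Graph n) → 9 ≤ n → Connected G →
    TwinBoundHalf G → PartitionDimAtMost G (n ∸ 3)
mainTheorem8 _ G n≥9@(s≤s (s≤s (s≤s _))) connected bound =
  separatedPairs⇒partitionDim G connected (separatedPairs G n≥9 bound)
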